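{- Let $P \in \mathcal{C}(G_n)$, and let $j$, $k \in Q_n$ with $j \neq k$. If $\{j\} \in \mathrm{char}(P)$, then $\{k\} \notin\mathrm{char}(P)$.
   Context: Let $Q_n=\{1,\dots,n\}$ be a set of $n$ yes/no questions; an outcome on $S\subseteq Q_n$ is an element of $\{0,1\}^{|S|}$, and $X_S$ is the set of outcomes on $S$. A preference matrix on $Q_n$ is a $2^n\times n$ 0-1 matrix whose rows are the $2^n$ outcomes, each exactly once, ordered from most to least preferred. For a nonempty proper $S\subset Q_n$ and outcome $x$ on $Q_n-S$, $P^{[Q_n-S,x]}$ is the submatrix formed by the columns in $S$ and rows with outcome $x$ on $Q_n-S$ (in order); $S$ is separable with respect to $P$ if $P^{[Q_n-S,x]}=P^{[Q_n-S,y]}$ for all $x,y\in X_{Q_n-S}$; $\emptyset$ and $Q_n$ are always separable. The character $\mathrm{char}(P)$ is the set of all subsets of $Q_n$ separable with respect to $P$. $\mathcal{C}(G_n)$ is the set of preference matrices generated by Hamiltonian paths in the $n$-dimensional hypercube graph $G_n$ with Gray code labeling, i.e. preference matrices in which consecutive rows differ in exactly one entry. -}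

module Defs where

open import Data.Bool using (Bool; true; false; if_then_else_; not; _∧_)
open import Data.Bool.Properties using () renaming (_≟_ to _≟ᵇ_)
open import Data.Nat using (ℕ; zero; suc; _+_; _^_)
open import Data.Fin using (Fin)
open import Data.Fin.Subset using (Subset; _∈_; _∉_; Empty; ⁅_⁆)
open import Data.Vec using (Vec; []; _∷_; lookup; allFin; toList)
open import Data.List using (List; []; _∷_; length; filter; map)
import Data.List.Membership.Propositional as LM
open import Data.List.Relation.Unary.Unique.Propositional using (Unique)
open import Data.List.Relation.Unary.Linked using (Linked)
open import Relation.Binary.PropositionalEquality using (_≡_)
open import Relation.Nullary using (¬_; Dec; yes; no)
open import Data.Product using (_×_)
open import Data.Sum using (_⊎_)

-- An outcome on Q_n = {1..n} (indexed here by Fin n) is a 0-1 vector of length n.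
Outcome : ℕ → Set
Outcome n = Vec Bool n

-- A preference matrix on Q_n: the list of its rows (most preferred first),
-- containing every outcome exactly once (hence 2^n rows).
record PreferenceMatrix (n : ℕ) : Set where
  field
    rows     : List (Outcome n)
    complete : ∀ (x : Outcome n) → x LM.∈ rows
    unique   : Unique rows
open PreferenceMatrix public

hamming : ∀ {n} → Outcome n → Outcome n → ℕ
hamming []       []       = 0
hamming (a ∷ as) (b ∷ bs) with a ≟ᵇ b
... | yes _ = hamming as bs
... | no  _ = suc (hamming as bs)

DifferInOne : ∀ {n} → Outcome n → Outcome n → Set
DifferInOne x y = hamming x y ≡ 1

-- P ∈ C(G_n): preference matrices generated by Hamiltonian paths in the
-- n-cube, i.e. consecutive rows differ in exactly one entry.
InCGn : ∀ {n} → PreferenceMatrix n → Set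
InCGn P = Linked DifferInOne (rows P)

agreeOff : ∀ {n} → Subset n → Outcome n → Outcome n → Bool
agreeOff []          []       []       = true
agreeOff (true ∷ S)  (_ ∷ r)  (_ ∷ x)  = agreeOff S r x
agreeOff (false ∷ S) (a ∷ r)  (b ∷ x)  = (if a then b else not b) ∧ agreeOff S r x

project : ∀ {n} → Subset n → Outcome n → List Bool
project []          []      = []
project (true ∷ S)  (a ∷ r) = a ∷ project S r
project (false ∷ S) (_ ∷ r) = project S r

-- P^[Q_n - S, x]: rows whose outcome on Q_n - S equals (the restriction of) x,
-- in order, restricted to the columns in S.  An outcome on Q_n - S is
-- represented by any full outcome x, of which only the entries off S matter.
subMatrix : ∀ {n} → PreferenceMatrix n → Subset n → Outcome n → List (List Bool)
subMatrix P S x = map (project S) (filter (λ r → agreeOff S r x ≡? true) (rows P))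
  where
    _≡?_ : (a b : Bool) → Dec (a ≡ b)
    _≡?_ = _≟ᵇ_

Full : ∀ {n} → Subset n → Set
Full S = ∀ i → i ∈ S

-- S is separable w.r.t. P (∅ and Q_n always are).
Separable : ∀ {n} → PreferenceMatrix n → Subset n → Set
Separable {n} P S = Empty S ⊎ Full S ⊎ (∀ (x y : Outcome n) → subMatrix P S x ≡ subMatrix P S y)

_∈char_ : ∀ {n} → Subset n → PreferenceMatrix n → Set
S ∈char P = Separable P S

-- If {j} is separable, then in every pair of outcomes differing only in column j the one
-- with j-entry d_j (the leading entry of P^[Q_n-{j},x], the same for all x) comes first.
-- Along a Gray-code path column j can only change across such a pair, hence only from d_j
-- to not d_j: the column reads d_j ... d_j, not d_j ... not d_j.  If {k} were separable
-- too, the outcome with entries (not d_j, d_k) at (j, k) would have to come after the one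
-- with (d_j, not d_k) because of column j, and before it because of column k.
module Submission where

open import Defs
open import Data.Bool using (Bool; true; false; not)
open import Data.Bool.Properties using (not-¬; ¬-not) renaming (_≟_ to _≟ᵇ_)
open import Data.Empty using (⊥-elim)
open import Data.Fin using (Fin; zero; suc)
open import Data.Fin.Subset using (Subset; ⁅_⁆) renaming (⊥ to ∅)
open import Data.Fin.Subset.Properties using (x∈⁅x⁆; x∈⁅y⁆⇒x≡y)
open import Data.List using (List; []; _∷_; _++_; [_]; filter; map)
open import Data.List.Properties using (filter-accept; filter-none; filter-++; ++-assoc)
open import Data.List.Membership.Propositional using (_∈_; _∉_)
open import Data.List.Membership.Propositional.Properties using (∈-∃++; ∈-++⁻; ∈-++⁺ʳ)
open import Data.List.Relation.Unary.All as All using (All; []; _∷_)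
open import Data.List.Relation.Unary.Any using (here; there)
open import Data.List.Relation.Unary.Linked as Linked using (Linked)
open import Data.List.Relation.Unary.Unique.Propositional using (Unique; _∷_)
open import Data.Nat using (ℕ; pred)
open import Data.Product using (∃₂; _×_; _,_)
open import Data.Sum using (_⊎_; inj₁; inj₂; [_,_]′)
open import Data.Vec using (Vec; []; _∷_; lookup; replicate; _[_]≔_)
open import Data.Vec.Properties using (lookup∘update; lookup∘update′; []≔-lookup)
open import Function using (_∘_)
open import Relation.Binary.PropositionalEquality using (_≡_; _≢_; refl; sym; trans; cong; cong₂; subst; module ≡-Reasoning)
open import Relation.Nullary using (¬_; yes; no)

flipAt : ∀ {n} → Fin n → Outcome n → Outcome n
flipAt j r = r [ j ]≔ not (lookup r j)

agreeOff-refl : ∀ {n} (S : Subset n) (r : Outcome n) → agreeOff S r r ≡ true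
agreeOff-refl []          []          = refl
agreeOff-refl (true ∷ S)  (_ ∷ r)     = agreeOff-refl S r
agreeOff-refl (false ∷ S) (true ∷ r)  = agreeOff-refl S r
agreeOff-refl (false ∷ S) (false ∷ r) = agreeOff-refl S r

agreeOff-∅⇒≡ : ∀ {n} (t r : Outcome n) → agreeOff ∅ t r ≡ true → t ≡ r
agreeOff-∅⇒≡ []          []          _  = refl
agreeOff-∅⇒≡ (true ∷ t)  (true ∷ r)  eq = cong (true ∷_) (agreeOff-∅⇒≡ t r eq)
agreeOff-∅⇒≡ (false ∷ t) (false ∷ r) eq = cong (false ∷_) (agreeOff-∅⇒≡ t r eq)

agreeOff-⁅⁆⇒≡[]≔ : ∀ {n} (j : Fin n) (t r : Outcome n) →
  agreeOff ⁅ j ⁆ t r ≡ true → t ≡ r [ j ]≔ lookup t j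
agreeOff-⁅⁆⇒≡[]≔ zero    (a ∷ t)     (_ ∷ r)     eq = cong (a ∷_) (agreeOff-∅⇒≡ t r eq)
agreeOff-⁅⁆⇒≡[]≔ (suc j) (true ∷ t)  (true ∷ r)  eq = cong (true ∷_) (agreeOff-⁅⁆⇒≡[]≔ j t r eq)
agreeOff-⁅⁆⇒≡[]≔ (suc j) (false ∷ t) (false ∷ r) eq = cong (false ∷_) (agreeOff-⁅⁆⇒≡[]≔ j t r eq)

agreeOff-⁅⁆⇒≡⊎≡flipAt : ∀ {n} (j : Fin n) (t r : Outcome n) →
  agreeOff ⁅ j ⁆ t r ≡ true → t ≡ r ⊎ t ≡ flipAt j r
agreeOff-⁅⁆⇒≡⊎≡flipAt j t r eq with t≡ ← agreeOff-⁅⁆⇒≡[]≔ j t r eq | lookup t j ≟ᵇ lookup r j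
... | yes tj≡rj = inj₁ (trans t≡ (trans (cong (r [ j ]≔_) tj≡rj) ([]≔-lookup r j)))
... | no  tj≢rj = inj₂ (trans t≡ (cong (r [ j ]≔_) (¬-not tj≢rj)))

project-∅ : ∀ {n} (t : Outcome n) → project ∅ t ≡ []
project-∅ []      = refl
project-∅ (_ ∷ t) = project-∅ t

project-⁅⁆ : ∀ {n} (j : Fin n) (t : Outcome n) → project ⁅ j ⁆ t ≡ [ lookup t j ]
project-⁅⁆ zero    (a ∷ t) = cong (a ∷_) (project-∅ t)
project-⁅⁆ (suc j) (_ ∷ t) = project-⁅⁆ j t

hamming≡0⇒≡ : ∀ {n} (r s : Outcome n) → hamming r s ≡ 0 → r ≡ s
hamming≡0⇒≡ []      []      _ = refl
hamming≡0⇒≡ (a ∷ r) (b ∷ s) h with a ≟ᵇ b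
hamming≡0⇒≡ (a ∷ r) (.a ∷ s) h | yes refl = cong (a ∷_) (hamming≡0⇒≡ r s h)
hamming≡0⇒≡ (a ∷ r) (b ∷ s) () | no _

hamming≡1⇒≡flipAt : ∀ {n} (j : Fin n) (r s : Outcome n) →
  hamming r s ≡ 1 → lookup r j ≢ lookup s j → s ≡ flipAt j r
hamming≡1⇒≡flipAt zero (a ∷ r) (b ∷ s) h a≢b with a ≟ᵇ b
... | yes a≡b = ⊥-elim (a≢b a≡b)
... | no  _   = cong₂ _∷_ (¬-not (a≢b ∘ sym)) (sym (hamming≡0⇒≡ r s (cong pred h)))
hamming≡1⇒≡flipAt (suc j) (a ∷ r) (b ∷ s) h rj≢sj with a ≟ᵇ b
... | yes refl = cong (a ∷_) (hamming≡1⇒≡flipAt j r s h rj≢sj)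
... | no  _    = ⊥-elim (rj≢sj (cong (λ w → lookup w j) (hamming≡0⇒≡ r s (cong pred h))))

module _ {A : Set} where

  Precedes : List A → A → A → Set
  Precedes xs a b = ∃₂ λ ys zs → xs ≡ ys ++ a ∷ zs × b ∈ zs

  precedes-total : ∀ {xs : List A} {a b} → a ∈ xs → b ∈ xs → a ≢ b →
    Precedes xs a b ⊎ Precedes xs b a
  precedes-total {a = a} {b} a∈xs b∈xs a≢b with ys , zs , refl ← ∈-∃++ a∈xs = split (∈-++⁻ ys b∈xs)
    where
    split : b ∈ ys ⊎ b ∈ a ∷ zs → Precedes (ys ++ a ∷ zs) a b ⊎ Precedes (ys ++ a ∷ zs) b a
    split (inj₂ (here b≡a))  = ⊥-elim (a≢b (sym b≡a))
    split (inj₂ (there b∈zs)) = inj₁ (ys , zs , refl , b∈zs)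
    split (inj₁ b∈ys) with us , vs , refl ← ∈-∃++ b∈ys =
      inj₂ (us , vs ++ a ∷ zs , ++-assoc us (b ∷ vs) (a ∷ zs) , ∈-++⁺ʳ vs (here refl))

  unique-++⇒disjoint : ∀ (ys : List A) {zs x} → Unique (ys ++ zs) → x ∈ ys → x ∉ zs
  unique-++⇒disjoint (y ∷ ys) (y∉ ∷ _) (here refl) x∈zs = All.lookup y∉ (∈-++⁺ʳ ys x∈zs) refl
  unique-++⇒disjoint (y ∷ ys) (_ ∷ u)  (there x∈ys) = unique-++⇒disjoint ys u x∈ys

  linked-++⁻ʳ : ∀ {R : A → A → Set} (ys : List A) {zs} → Linked R (ys ++ zs) → Linked R zs
  linked-++⁻ʳ []       l = l
  linked-++⁻ʳ (_ ∷ ys) l = linked-++⁻ʳ ys (Linked.tail l)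

headEntry : List (List Bool) → Bool
headEntry ((b ∷ _) ∷ _) = b
headEntry _             = false

-- The j-entry of the first row of P^[Q_n-{j},x]; the value on an empty submatrix is junk,
-- but submatrices of a preference matrix are never empty.
leadingEntry : ∀ {n} → PreferenceMatrix n → Fin n → Outcome n → Bool
leadingEntry P j x = headEntry (subMatrix P ⁅ j ⁆ x)

leadingEntry-edge : ∀ {n} (P : PreferenceMatrix n) (j : Fin n) {ys r s zs} →
  rows P ≡ ys ++ r ∷ s ∷ zs → hamming r s ≡ 1 → lookup r j ≢ lookup s j →
  leadingEntry P j r ≡ lookup r j
leadingEntry-edge P j {ys} {r} {s} {zs} rows≡ h rj≢sj = begin
  headEntry (map π (filter q (rows P)))
    ≡⟨ cong (headEntry ∘ map π ∘ filter q) rows≡ ⟩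
  headEntry (map π (filter q (ys ++ r ∷ s ∷ zs)))
    ≡⟨ cong (headEntry ∘ map π) (filter-++ q ys (r ∷ s ∷ zs)) ⟩
  headEntry (map π (filter q ys ++ filter q (r ∷ s ∷ zs)))
    ≡⟨ cong (λ us → headEntry (map π (us ++ filter q (r ∷ s ∷ zs)))) (filter-none q ys-rejected) ⟩
  headEntry (map π (filter q (r ∷ s ∷ zs)))
    ≡⟨ cong (headEntry ∘ map π) (filter-accept q (agreeOff-refl ⁅ j ⁆ r)) ⟩
  headEntry (π r ∷ map π (filter q (s ∷ zs)))
    ≡⟨ cong (λ row → headEntry (row ∷ map π (filter q (s ∷ zs)))) (project-⁅⁆ j r) ⟩
  lookup r j ∎
  where
  open ≡-Reasoning
  π = project ⁅ j ⁆
  q = λ t → agreeOff ⁅ j ⁆ t r ≟ᵇ true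
  ys-rejected : All (λ t → ¬ agreeOff ⁅ j ⁆ t r ≡ true) ys
  ys-rejected = All.tabulate λ t∈ys → unique-++⇒disjoint ys unique-rows t∈ys ∘ pair-member
    where
    unique-rows = subst Unique rows≡ (unique P)
    pair-member : ∀ {t} → agreeOff ⁅ j ⁆ t r ≡ true → t ∈ r ∷ s ∷ zs
    pair-member {t} agrees with agreeOff-⁅⁆⇒≡⊎≡flipAt j t r agrees
    ... | inj₁ t≡r     = here t≡r
    ... | inj₂ t≡flipAt = there (here (trans t≡flipAt (sym (hamming≡1⇒≡flipAt j r s h rj≢sj))))

singleton-separable⇒subMatrix-constant : ∀ {n} (P : PreferenceMatrix n) {j k : Fin n} →
  j ≢ k → ⁅ j ⁆ ∈char P → ∀ x y → subMatrix P ⁅ j ⁆ x ≡ subMatrix P ⁅ j ⁆ y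
singleton-separable⇒subMatrix-constant P {j} {k} j≢k (inj₁ empty)          = ⊥-elim (empty (j , x∈⁅x⁆ j))
singleton-separable⇒subMatrix-constant P {j} {k} j≢k (inj₂ (inj₁ full))    = ⊥-elim (j≢k (sym (x∈⁅y⁆⇒x≡y j (full k))))
singleton-separable⇒subMatrix-constant P         j≢k (inj₂ (inj₂ constant)) = constant

module _ {n} (P : PreferenceMatrix n) (gray : InCGn P) (j : Fin n)
         (separable : ∀ x y → subMatrix P ⁅ j ⁆ x ≡ subMatrix P ⁅ j ⁆ y) (x : Outcome n) where

  lookup≡not-leadingEntry-persists : ∀ {r t} → Precedes (rows P) r t →
    lookup r j ≡ not (leadingEntry P j x) → lookup t j ≡ not (leadingEntry P j x)
  lookup≡not-leadingEntry-persists (ys , zs , rows≡ , t∈zs) rj≡¬d =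
    All.lookup (persists ys zs rows≡ rj≡¬d) t∈zs
    where
    d = leadingEntry P j x
    persists : ∀ ys {r} zs → rows P ≡ ys ++ r ∷ zs → lookup r j ≡ not d → All (λ t → lookup t j ≡ not d) zs
    persists ys []       _     _      = []
    persists ys {r} (s ∷ zs) rows≡ rj≡¬d = sj≡¬d ∷ persists (ys ++ [ r ]) zs rows≡′ sj≡¬d
      where
      rows≡′ = trans rows≡ (sym (++-assoc ys [ r ] (s ∷ zs)))
      edge : DifferInOne r s
      edge = Linked.head (linked-++⁻ʳ ys (subst (Linked DifferInOne) rows≡ gray))
      -- An edge changing column j starts at the leading entry of its pair, which is d.
      sj≡¬d : lookup s j ≡ not d
      sj≡¬d with lookup r j ≟ᵇ lookup s j
      ... | yes rj≡sj = trans (sym rj≡sj) rj≡¬d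
      ... | no  rj≢sj = ⊥-elim (not-¬ rj≡d rj≡¬d)
        where rj≡d = trans (sym (leadingEntry-edge P j rows≡ edge rj≢sj)) (cong headEntry (separable r x))

lookup∘update∘update′ : ∀ {n} {A : Set} {j k : Fin n} → j ≢ k → (xs : Vec A n) (a b : A) →
  lookup (xs [ j ]≔ a [ k ]≔ b) j ≡ a
lookup∘update∘update′ {j = j} j≢k xs a b = trans (lookup∘update′ j≢k (xs [ j ]≔ a) b) (lookup∘update j xs a)

corollary3 : ∀ {n : ℕ} (P : PreferenceMatrix n) → InCGn P →
    (j k : Fin n) → j ≢ k → ⁅ j ⁆ ∈char P → ¬ (⁅ k ⁆ ∈char P)
corollary3 {n} P gray j k j≢k ⁅j⁆-separable ⁅k⁆-separable =
  [ (λ u≺v → not-¬ vj≡dj (persists-j u≺v uj≡¬dj))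
  , (λ v≺u → not-¬ uk≡dk (persists-k v≺u vk≡¬dk)) ]′
  (precedes-total (complete P u) (complete P v) u≢v)
  where
  x = replicate n false
  dj = leadingEntry P j x
  dk = leadingEntry P k x
  u v : Outcome n
  u = x [ j ]≔ not dj [ k ]≔ dk
  v = x [ j ]≔ dj [ k ]≔ not dk
  uj≡¬dj = lookup∘update∘update′ j≢k x (not dj) dk
  vj≡dj  = lookup∘update∘update′ j≢k x dj (not dk)
  uk≡dk  = lookup∘update k (x [ j ]≔ not dj) dk
  vk≡¬dk = lookup∘update k (x [ j ]≔ dj) (not dk)
  u≢v : u ≢ v
  u≢v u≡v = not-¬ vj≡dj (trans (cong (λ w → lookup w j) (sym u≡v)) uj≡¬dj)
  persists-j = lookup≡not-leadingEntry-persists P gray j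
    (singleton-separable⇒subMatrix-constant P j≢k ⁅j⁆-separable) x
  persists-k = lookup≡not-leadingEntry-persists P gray k
    (singleton-separable⇒subMatrix-constant P (j≢k ∘ sym) ⁅k⁆-separable) x
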